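{- Suppose $n,\Delta \in \mathbb{N}\setminus \{1\}$ and $n\geq t\geq 1$. Then for any rooted tree $(T,r)$ on $n$ vertices with $\Delta(T)\leq \Delta$ there exists a collection $\mathcal{S}$ of pairwise vertex-disjoint rooted subtrees of $T$ such that (I) $S\subseteq T(s)$ for every $(S,s)\in \mathcal{S}$; (II) $t \leq |S|\leq 2\Delta t$ for every $(S,s)\in \mathcal{S}$; and (III) $\bigcup_{(S,s)\in\mathcal{S}}V(S)=V(T)$.
   Context: $(S,s)$ denotes a tree $S$ rooted at $s$. For $v\in V(T)$, $T(v)$ is the subtree of $T$ induced by all vertices $u$ such that the path from $u$ to the root $r$ contains $v$ (including $v$). -}

module Defs where

open import Data.Nat using (ℕ; _≤_; _*_)
open import Data.Fin using (Fin)
open import Data.Bool using (Bool; true; false)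
open import Data.Maybe using (just)
open import Data.List using (List; []; _∷_; length; head; last)
open import Data.List.Relation.Unary.Linked using (Linked)
open import Data.List.Relation.Unary.All using (All)
open import Data.List.Relation.Unary.AllPairs using (AllPairs)
open import Data.List.Relation.Unary.Any using (Any)
open import Data.List.Membership.Propositional using () renaming (_∈_ to _∈ₗ_)
open import Data.List.Relation.Unary.Unique.Propositional using (Unique)
open import Data.Vec using (tabulate)
open import Data.Fin.Subset using (Subset; _∈_; ∣_∣)
open import Data.Product using (Σ; _×_; ∃; _,_; proj₁; proj₂)
open import Relation.Binary.PropositionalEquality using (_≡_; _≢_)
open import Relation.Nullary using (¬_)
open import Data.Empty using (⊥)

record Graph (n : ℕ) : Set where
  field
    adj     : Fin n → Fin n → Bool
    sym     : ∀ u v → adj u v ≡ adj v u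
    irrefl  : ∀ v → adj v v ≡ false
open Graph public

module _ {n : ℕ} (G : Graph n) where

  Adj : Fin n → Fin n → Set
  Adj u v = adj G u v ≡ true

  degree : Fin n → ℕ
  degree v = ∣ tabulate (adj G v) ∣

  MaxDegree≤ : ℕ → Set
  MaxDegree≤ D = ∀ v → degree v ≤ D

  IsPath : Fin n → Fin n → List (Fin n) → Set
  IsPath u v xs = Linked Adj xs × Unique xs × head xs ≡ just u × last xs ≡ just v

  IsCycle : List (Fin n) → Set
  IsCycle [] = ⊥
  IsCycle (x ∷ xs) = 3 ≤ length (x ∷ xs) × Linked Adj (x ∷ xs) × Unique (x ∷ xs)
                     × Σ (Fin n) (λ y → last (x ∷ xs) ≡ just y × Adj y x)

  Connected : Set
  Connected = ∀ u v → ∃ λ xs → IsPath u v xs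

  Acyclic : Set
  Acyclic = ∀ xs → ¬ IsCycle xs

  IsTree : Set
  IsTree = Connected × Acyclic

  InducedConnected : Subset n → Set
  InducedConnected U = ∀ u v → u ∈ U → v ∈ U → ∃ λ xs → IsPath u v xs × All (_∈ U) xs

  -- u ∈ V(T(v)) for the tree rooted at r: the path from u to r contains v
  InRootedSubtree : (r v u : Fin n) → Set
  InRootedSubtree r v u = ∀ xs → IsPath u r xs → v ∈ₗ xs

-- A rooted subtree (S,s) of a tree T is given by its vertex set U = V(S)
-- (with T[U] connected, so S = T[U]) together with its root s ∈ U.
RootedSubtree : ℕ → Set
RootedSubtree n = Subset n × Fin n

module _ {n : ℕ} (T : Graph n) (r : Fin n) where

  IsRootedSubtree : RootedSubtree n → Set
  IsRootedSubtree (U , s) = s ∈ U × InducedConnected T U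

  BelowRoot : RootedSubtree n → Set
  BelowRoot (U , s) = ∀ u → u ∈ U → InRootedSubtree T r s u

  VertexDisjoint : RootedSubtree n → RootedSubtree n → Set
  VertexDisjoint (U , _) (W , _) = ∀ v → v ∈ U → v ∈ W → ⊥

  Covers : List (RootedSubtree n) → Set
  Covers 𝒮 = ∀ v → Any (λ S → v ∈ proj₁ S) 𝒮

module Submission where

-- Greedy peeling from the bottom of the tree. Keep a vertex set W that contains every
-- ancestor of each of its vertices; then for every w ∈ W the set W ∩ V(T(w)) is connected,
-- rooted at w and lies below w. If |W| ≤ 2Δt, W itself (rooted at r) is the last piece.
-- Otherwise walk down from r to a vertex w with |W ∩ V(T(w))| ≥ t all of whose children c
-- have |W ∩ V(T(c))| < t; as w has at most Δ children, |W ∩ V(T(w))| ≤ 1 + Δ(t - 1) ≤ Δt.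
-- Removing this piece keeps W ancestor-closed and leaves more than 2Δt - Δt ≥ t vertices,
-- so the process continues until W is exhausted.

open import Defs hiding (sym)
open import Data.Nat using (ℕ; zero; suc; _+_; _*_; _≤_; _<_; z≤n; s≤s; >-nonZero)
open import Data.Nat.Properties
  using ( ≤-reflexive; ≤-trans; <⇒≤; ≤-pred; ≰⇒>; _≤?_; m≤m+n; m≤n*m; +-identityʳ; +-suc; *-suc; *-assoc
        ; +-monoˡ-≤; +-monoʳ-≤; +-mono-≤; *-monoˡ-≤; +-cancelʳ-<; module ≤-Reasoning )
open import Data.Fin using (Fin; zero; suc)
open import Data.Fin.Subset
  using (Subset; inside; outside; ⊤; _∈_; _∉_; _⊆_; _⊂_; _∩_; _∪_; _─_; ∣_∣; ⁅_⁆; Nonempty)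
  renaming (⊥ to ∅)
open import Data.Fin.Subset.Properties
  using ( ∣p∣≤∣x∷p∣; x∈p∪q⁺; x∈p∩q⁺; x∈p∩q⁻; x∈⁅x⁆; ∣⁅x⁆∣≡1; p─q⊆p; x∈p∧x∉q⇒x∈p─q
        ; _∈?_; ∈⊤; ∣⊤∣≡n; x∈p⇒∣p-x∣<∣p∣; p⊆q⇒∣p∣≤∣q∣; p⊂q⇒∣p∣<∣q∣; ∣p∩q∣≤∣p∣; p∩q≢∅⇒∣p─q∣<∣p∣; nonempty?; Empty-unique; ∣⊥∣≡0 )
open import Data.Bool using (Bool; true)
open import Data.Vec using (tabulate; _∷_; []; here; there)
open import Data.Vec.Properties using (lookup∘tabulate; []=⇒lookup; lookup⇒[]=)
open import Data.List using (List; []; _∷_; _++_; _∷ʳ_; length; head; last; initLast; _∷ʳ′_)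
open import Data.List.Properties using (≡-dec; ++-assoc; ∷-injectiveˡ)
open import Data.List.Relation.Unary.All as All using (All; []; _∷_)
open import Data.List.Relation.Unary.All.Properties using (¬Any⇒All¬; anti-mono; ++⁺)
open import Data.List.Relation.Unary.AllPairs using (AllPairs; []; _∷_)
open import Data.List.Relation.Unary.Any using (Any; here; there)
open import Data.List.Relation.Unary.Linked using (Linked; []; [-]; _∷_)
open import Data.List.Relation.Unary.Unique.Propositional using (Unique)
open import Data.List.Membership.Propositional using () renaming (_∈_ to _∈ₗ_)
open import Data.List.Membership.Propositional.Properties using (∈-∃++; ∈-++⁺ˡ; ∈-++⁺ʳ; ∈-++⁻)
open import Data.List.Relation.Binary.Subset.Propositional using () renaming (_⊆_ to _⊆ₗ_)
import Data.List.Membership.DecPropositional as DecMembership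
open import Data.Fin.Properties using (_≟_; any?)
open import Data.Maybe using (just)
open import Data.Product using (∃; _,_; _×_; proj₁; proj₂)
open import Data.Sum using (_⊎_; inj₁; inj₂)
open import Relation.Nullary using (¬_; Dec; yes; no; does; contradiction)
open import Relation.Nullary.Decidable using (_×-dec_)
open import Induction.WellFounded using (Acc; acc)
open import Data.Nat.Induction using (<-wellFounded)
open import Relation.Unary using (Pred; Decidable)
open import Relation.Binary.PropositionalEquality using (_≡_; _≢_; refl; sym; trans; subst; cong)

private variable
  m n k : ℕ
  A : Set

∈-tabulate⁺ : ∀ (f : Fin n → Bool) {x} → f x ≡ true → x ∈ tabulate f
∈-tabulate⁺ f {x} fx = lookup⇒[]= x (tabulate f) (trans (lookup∘tabulate f x) fx)

∈-tabulate⁻ : ∀ (f : Fin n → Bool) {x} → x ∈ tabulate f → f x ≡ true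
∈-tabulate⁻ f {x} x∈ = trans (sym (lookup∘tabulate f x)) ([]=⇒lookup x∈)

⟦_⟧ : ∀ {ℓ} {P : Pred (Fin n) ℓ} → Decidable P → Subset n
⟦ P? ⟧ = tabulate (λ x → does (P? x))

module _ {ℓ} {P : Pred (Fin n) ℓ} (P? : Decidable P) where

  ∈⟦⟧⁺ : ∀ {x} → P x → x ∈ ⟦ P? ⟧
  ∈⟦⟧⁺ {x} px with P? x in eq
  ... | yes _ = ∈-tabulate⁺ (λ y → does (P? y)) (cong does eq)
  ... | no ¬px = contradiction px ¬px

  ∈⟦⟧⁻ : ∀ {x} → x ∈ ⟦ P? ⟧ → P x
  ∈⟦⟧⁻ {x} x∈ with P? x | ∈-tabulate⁻ (λ y → does (P? y)) x∈
  ... | yes px | _ = px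

∣p∪q∣≤∣p∣+∣q∣ : ∀ (p q : Subset n) → ∣ p ∪ q ∣ ≤ ∣ p ∣ + ∣ q ∣
∣p∪q∣≤∣p∣+∣q∣ []            []            = z≤n
∣p∪q∣≤∣p∣+∣q∣ (inside  ∷ p) (y       ∷ q) =
  s≤s (≤-trans (∣p∪q∣≤∣p∣+∣q∣ p q) (+-monoʳ-≤ ∣ p ∣ (∣p∣≤∣x∷p∣ y q)))
∣p∪q∣≤∣p∣+∣q∣ (outside ∷ p) (outside ∷ q) = ∣p∪q∣≤∣p∣+∣q∣ p q
∣p∪q∣≤∣p∣+∣q∣ (outside ∷ p) (inside  ∷ q) =
  subst (suc ∣ p ∪ q ∣ ≤_) (sym (+-suc ∣ p ∣ ∣ q ∣)) (s≤s (∣p∪q∣≤∣p∣+∣q∣ p q))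

x∈p─q⇒x∉q : ∀ (p q : Subset n) {x} → x ∈ p ─ q → x ∉ q
x∈p─q⇒x∉q (_ ∷ p) (outside ∷ q) (there x∈) (there x∈q) = x∈p─q⇒x∉q p q x∈ x∈q
x∈p─q⇒x∉q (_ ∷ p) (inside  ∷ q) (there x∈) (there x∈q) = x∈p─q⇒x∉q p q x∈ x∈q

0<∣p∣⇒nonempty : ∀ {n} (p : Subset n) → 0 < ∣ p ∣ → Nonempty p
0<∣p∣⇒nonempty {n} p 0<∣p∣ with nonempty? p
... | yes ne = ne
... | no ¬ne = contradiction (subst (0 <_) ∣p∣≡0 0<∣p∣) λ ()
  where
  ∣p∣≡0 : ∣ p ∣ ≡ 0
  ∣p∣≡0 = trans (cong ∣_∣ (Empty-unique ¬ne)) (∣⊥∣≡0 n)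

∣p∣≤∣p─q∣+∣q∣ : ∀ (p q : Subset n) → ∣ p ∣ ≤ ∣ p ─ q ∣ + ∣ q ∣
∣p∣≤∣p─q∣+∣q∣ p q = ≤-trans (p⊆q⇒∣p∣≤∣q∣ split) (∣p∪q∣≤∣p∣+∣q∣ (p ─ q) q)
  where
  split : p ⊆ (p ─ q) ∪ q
  split {x} x∈p with x ∈? q
  ... | yes x∈q = x∈p∪q⁺ (inj₂ x∈q)
  ... | no  x∉q = x∈p∪q⁺ (inj₁ (x∈p∧x∉q⇒x∈p─q x∈p x∉q))

⋃[_]_ : Subset n → (Fin n → Subset m) → Subset m
⋃[ []          ] A = ∅
⋃[ inside  ∷ N ] A = A zero ∪ ⋃[ N ] (λ c → A (suc c))
⋃[ outside ∷ N ] A = ⋃[ N ] (λ c → A (suc c))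

∈⋃⁺ : ∀ (N : Subset n) (A : Fin n → Subset m) {c x} → c ∈ N → x ∈ A c → x ∈ ⋃[ N ] A
∈⋃⁺ (inside  ∷ N) A here       x∈ = x∈p∪q⁺ (inj₁ x∈)
∈⋃⁺ (inside  ∷ N) A (there c∈) x∈ = x∈p∪q⁺ (inj₂ (∈⋃⁺ N (λ c → A (suc c)) c∈ x∈))
∈⋃⁺ (outside ∷ N) A (there c∈) x∈ = ∈⋃⁺ N (λ c → A (suc c)) c∈ x∈

∣⋃∣≤∣N∣*k : ∀ (N : Subset n) (A : Fin n → Subset m) →
  (∀ {c} → c ∈ N → ∣ A c ∣ ≤ k) → ∣ ⋃[ N ] A ∣ ≤ ∣ N ∣ * k
∣⋃∣≤∣N∣*k {m = m} []  A bound = subst (_≤ 0) (sym (∣⊥∣≡0 m)) z≤n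
∣⋃∣≤∣N∣*k (inside  ∷ N) A bound = ≤-trans (∣p∪q∣≤∣p∣+∣q∣ (A zero) _)
  (+-mono-≤ (bound here) (∣⋃∣≤∣N∣*k N (λ c → A (suc c)) (λ c∈ → bound (there c∈))))
∣⋃∣≤∣N∣*k (outside ∷ N) A bound = ∣⋃∣≤∣N∣*k N (λ c → A (suc c)) (λ c∈ → bound (there c∈))

1+m*n≤m*[1+n] : ∀ {m} n → 1 ≤ m → 1 + m * n ≤ m * suc n
1+m*n≤m*[1+n] {m} n 1≤m = subst (1 + m * n ≤_) (sym (*-suc m n)) (+-monoˡ-≤ (m * n) 1≤m)

2*m*n≡m*n+m*n : ∀ m n → 2 * m * n ≡ m * n + m * n
2*m*n≡m*n+m*n m n = trans (*-assoc 2 m n) (cong (m * n +_) (+-identityʳ (m * n)))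

≤-remainder : ∀ {Δ t a b} → 1 ≤ Δ → 2 * Δ * t < a → a ≤ b + Δ * t → t ≤ b
≤-remainder {Δ} {t} {a} {b} 1≤Δ 2Δt<a a≤b+Δt = ≤-trans (m≤n*m t Δ {{>-nonZero 1≤Δ}})
  (<⇒≤ (+-cancelʳ-< (Δ * t) (Δ * t) b (begin-strict
    Δ * t + Δ * t ≡⟨ sym (2*m*n≡m*n+m*n Δ t) ⟩
    2 * Δ * t     <⟨ 2Δt<a ⟩
    a             ≤⟨ a≤b+Δt ⟩
    b + Δ * t     ∎)))
  where open ≤-Reasoning

AllPairs-++⁻ʳ : ∀ {R : A → A → Set} (xs : List A) {ys} → AllPairs R (xs ++ ys) → AllPairs R ys
AllPairs-++⁻ʳ []       rs       = rs
AllPairs-++⁻ʳ (x ∷ xs) (_ ∷ rs) = AllPairs-++⁻ʳ xs rs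

module Walks {n : ℕ} (G : Graph n) where

  open DecMembership (_≟_ {n}) using () renaming (_∈?_ to _∈ₗ?_)

  private variable
    a b c x : Fin n
    xs ys pre suf : List (Fin n)

  Adj-sym : Adj G a b → Adj G b a
  Adj-sym {a} {b} ab = trans (Graph.sym G b a) ab

  data Walk : Fin n → Fin n → List (Fin n) → Set where
    stop : ∀ a → Walk a a (a ∷ [])
    step : Adj G a b → Walk b c xs → Walk a c (a ∷ xs)

  Path : Fin n → Fin n → List (Fin n) → Set
  Path a b xs = Walk a b xs × Unique xs

  walk-start : Walk a b xs → a ∈ₗ xs
  walk-start (stop _)   = here refl
  walk-start (step _ _) = here refl

  walk-end : Walk a b xs → b ∈ₗ xs
  walk-end (stop _)   = here refl
  walk-end (step _ w) = there (walk-end w)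

  walk-∷ : Walk a b xs → ∃ λ ys → xs ≡ a ∷ ys
  walk-∷ (stop _)   = _ , refl
  walk-∷ (step _ _) = _ , refl

  walk-length : Walk a b xs → a ≢ b → 2 ≤ length xs
  walk-length (stop _)            a≢a = contradiction refl a≢a
  walk-length (step _ (stop _))   _ = s≤s (s≤s z≤n)
  walk-length (step _ (step _ _)) _ = s≤s (s≤s z≤n)

  Walk⇒Linked : Walk a b xs → Linked (Adj G) xs
  Walk⇒Linked (stop _)              = [-]
  Walk⇒Linked (step ab (stop _))    = ab ∷ [-]
  Walk⇒Linked (step ab (step bc w)) = ab ∷ Walk⇒Linked (step bc w)

  walk-head : Walk a b xs → head xs ≡ just a
  walk-head (stop _)   = refl
  walk-head (step _ _) = refl

  walk-last : Walk a b xs → last xs ≡ just b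
  walk-last (stop _)             = refl
  walk-last (step _ (stop _))    = refl
  walk-last (step _ (step bc w)) = walk-last (step bc w)

  IsPath⇒Path : IsPath G a b xs → Path a b xs
  IsPath⇒Path (linked , unique , hd , lt) = walk _ linked hd lt , unique
    where
    walk : ∀ {a b} xs → Linked (Adj G) xs → head xs ≡ just a → last xs ≡ just b → Walk a b xs
    walk (x ∷ [])     _          refl refl = stop x
    walk (x ∷ y ∷ xs) (xy ∷ lnk) refl lt   = step xy (walk (y ∷ xs) lnk refl lt)

  Path⇒IsPath : Path a b xs → IsPath G a b xs
  Path⇒IsPath (w , unique) = Walk⇒Linked w , unique , walk-head w , walk-last w

  walk-suffix : ∀ pre → Walk a b (pre ++ x ∷ suf) → Walk x b (x ∷ suf)
  walk-suffix []            (stop _)    = stop _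
  walk-suffix []            (step ab w) = step ab w
  walk-suffix (_ ∷ [])      (step _ w)  = walk-suffix [] w
  walk-suffix (_ ∷ y ∷ pre) (step _ w)  = walk-suffix (y ∷ pre) w

  walk-prefix : ∀ pre → Walk a b (pre ++ x ∷ suf) → Walk a x (pre ++ x ∷ [])
  walk-prefix []            (stop _)    = stop _
  walk-prefix []            (step _ _)  = stop _
  walk-prefix (_ ∷ [])      (step ab w) = step ab (walk-prefix [] w)
  walk-prefix (_ ∷ y ∷ pre) (step ab w) = step ab (walk-prefix (y ∷ pre) w)

  _++ʷ_ : Walk a b xs → Walk b c ys → ∃ λ zs → Walk a c zs × zs ⊆ₗ xs ++ ys
  stop _    ++ʷ w′ = _ , w′ , there
  step ab w ++ʷ w′ with w ++ʷ w′
  ... | zs , w″ , zs⊆ = _ , step ab w″ , λ { (here refl) → here refl ; (there z∈) → there (zs⊆ z∈) }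

  reverseʷ : Walk a b xs → ∃ λ ys → Walk b a ys × ys ⊆ₗ xs
  reverseʷ (stop a) = _ , stop a , λ x∈ → x∈
  reverseʷ (step {a} ab w) with reverseʷ w
  ... | ys , w′ , ys⊆ with w′ ++ʷ step (Adj-sym ab) (stop a)
  ... | zs , w″ , zs⊆ = zs , w″ , λ z∈ → back (∈-++⁻ ys (zs⊆ z∈))
    where
    back : ∀ {z} → z ∈ₗ ys ⊎ z ∈ₗ _ ∷ a ∷ [] → z ∈ₗ a ∷ _
    back (inj₁ z∈)                 = there (ys⊆ z∈)
    back (inj₂ (here refl))        = there (walk-start w)
    back (inj₂ (there (here refl))) = here refl

  shortcut : Walk a b xs → ∃ λ ys → Path a b ys × ys ⊆ₗ xs
  shortcut (stop a) = _ , (stop a , [] ∷ []) , λ x∈ → x∈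
  shortcut (step {a} ab w) with shortcut w
  ... | ys , (w′ , unique) , ys⊆ with a ∈ₗ? ys
  ... | no a∉ys = a ∷ ys , (step ab w′ , ¬Any⇒All¬ ys a∉ys ∷ unique) ,
                  λ { (here refl) → here refl ; (there y∈) → there (ys⊆ y∈) }
  ... | yes a∈ys with ∈-∃++ a∈ys
  ... | pre , suf , refl = a ∷ suf , (walk-suffix pre w′ , AllPairs-++⁻ʳ pre unique) ,
                           λ z∈ → there (ys⊆ (∈-++⁺ʳ pre z∈))

  connect : Walk a c xs → Walk b c ys → ∃ λ zs → Path a b zs × zs ⊆ₗ xs ++ ys
  connect {xs = xs} {ys = ys} w w′ with reverseʷ w′
  ... | ys′ , w″ , ys′⊆ with w ++ʷ w″
  ... | zs , w‴ , zs⊆ with shortcut w‴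
  ... | ps , path , ps⊆ = ps , path , λ p∈ → widen (∈-++⁻ xs (zs⊆ (ps⊆ p∈)))
    where
    widen : ∀ {z} → z ∈ₗ xs ⊎ z ∈ₗ ys′ → z ∈ₗ xs ++ ys
    widen (inj₁ z∈) = ∈-++⁺ˡ z∈
    widen (inj₂ z∈) = ∈-++⁺ʳ xs (ys′⊆ z∈)

  -- Two different paths from a to b would diverge after a at neighbours c ≢ d of a;
  -- joining them back avoiding a closes a cycle through a.
  Acyclic⇒Path-unique : Acyclic G → Path a b xs → Path a b ys → xs ≡ ys
  Acyclic⇒Path-unique acyclic (stop _ , _) (stop _ , _) = refl
  Acyclic⇒Path-unique acyclic (stop _ , _) (step _ w , a∉ ∷ _) = contradiction refl (All.lookup a∉ (walk-end w))
  Acyclic⇒Path-unique acyclic (step _ w , a∉ ∷ _) (stop _ , _) = contradiction refl (All.lookup a∉ (walk-end w))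
  Acyclic⇒Path-unique acyclic (step {a} {c} ac w , a∉xs ∷ uxs) (step {b = d} ad w′ , a∉ys ∷ uys) with c ≟ d
  ... | yes refl = cong (a ∷_) (Acyclic⇒Path-unique acyclic (w , uxs) (w′ , uys))
  ... | no c≢d with connect w w′
  ... | zs , (w″ , uzs) , zs⊆ = contradiction cycle (acyclic (a ∷ zs))
    where
    cycle : IsCycle G (a ∷ zs)
    cycle = s≤s (walk-length w″ c≢d) , Walk⇒Linked (step ac w″) ,
            anti-mono zs⊆ (++⁺ a∉xs a∉ys) ∷ uzs , d , walk-last (step ac w″) , Adj-sym ad

  1≤degree : Connected G → a ≢ b → 1 ≤ degree G a
  1≤degree {a} {b} connected a≢b = first-step (proj₁ (IsPath⇒Path (proj₂ (connected a b))))
    where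
    first-step : Walk a b xs → 1 ≤ degree G a
    first-step (stop _)    = contradiction refl a≢b
    first-step (step ab _) = ≤-trans (s≤s z≤n) (x∈p⇒∣p-x∣<∣p∣ (∈-tabulate⁺ (adj G a) ab))

module RootedTree {n : ℕ} (T : Graph n) (tree : IsTree T) (r : Fin n) where

  open Walks T
  open DecMembership (_≟_ {n}) using () renaming (_∈?_ to _∈ₗ?_)

  private variable
    u v w c : Fin n
    xs pre suf : List (Fin n)
    W : Subset n

  path : Fin n → List (Fin n)
  path u = proj₁ (proj₁ tree u r)

  path-Path : ∀ u → Path u r (path u)
  path-Path u = IsPath⇒Path (proj₂ (proj₁ tree u r))

  IsPath⇒≡path : IsPath T u r xs → xs ≡ path u
  IsPath⇒≡path p = Acyclic⇒Path-unique (proj₂ tree) (IsPath⇒Path p) (path-Path _)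

  path-walk : ∀ u → Walk u r (path u)
  path-walk u = proj₁ (path-Path u)

  path-∷ : ∀ u → ∃ λ suf → path u ≡ u ∷ suf
  path-∷ u = walk-∷ (path-walk u)

  path-injective : path u ≡ path v → u ≡ v
  path-injective {u} {v} eq with path-∷ u | path-∷ v
  ... | _ , eu | _ , ev = ∷-injectiveˡ (trans (sym eu) (trans eq ev))

  path-suffix : ∀ pre → path u ≡ pre ++ w ∷ suf → path w ≡ w ∷ suf
  path-suffix {u} {w} pre eq with subst (Path u r) eq (path-Path u)
  ... | walk , unique =
    sym (Acyclic⇒Path-unique (proj₂ tree) (walk-suffix pre walk , AllPairs-++⁻ʳ pre unique) (path-Path w))

  -- v ≼ u: v lies on the path from u to the root, i.e. u ∈ V(T(v)).
  _≼_ : Fin n → Fin n → Set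
  v ≼ u = v ∈ₗ path u

  _≼?_ : ∀ v u → Dec (v ≼ u)
  v ≼? u = v ∈ₗ? path u

  ≼-refl : ∀ u → u ≼ u
  ≼-refl u = walk-start (path-walk u)

  root-≼ : ∀ u → r ≼ u
  root-≼ u = walk-end (path-walk u)

  ≼-trans : v ≼ w → w ≼ u → v ≼ u
  ≼-trans {v} v≼w w≼u with ∈-∃++ w≼u
  ... | pre , suf , eq = subst (v ∈ₗ_) (sym eq) (∈-++⁺ʳ pre (subst (v ∈ₗ_) (path-suffix pre eq) v≼w))

  subtree : Fin n → Subset n
  subtree v = ⟦ v ≼?_ ⟧

  Child : Fin n → Fin n → Set
  Child w c = path c ≡ c ∷ path w

  Child? : ∀ w c → Dec (Child w c)
  Child? w c = ≡-dec _≟_ (path c) (c ∷ path w)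

  children : Fin n → Subset n
  children w = ⟦ Child? w ⟧

  Child⇒Adj : Child w c → Adj T w c
  Child⇒Adj {w} {c} ch with path-∷ w
  ... | suf , eq with Walk⇒Linked (subst (Walk c r) (trans ch (cong (c ∷_) eq)) (path-walk c))
  ... | cw ∷ _ = Adj-sym cw

  Child⇒≼ : Child w c → w ≼ c
  Child⇒≼ {w} ch = subst (w ∈ₗ_) (sym ch) (there (≼-refl w))

  Child⇒⋠ : Child w c → ¬ c ≼ w
  Child⇒⋠ {w} {c} ch c≼w with subst Unique ch (proj₂ (path-Path c))
  ... | c∉ ∷ _ = All.lookup c∉ c≼w refl

  ≼-Child : v ≼ u → u ≢ v → ∃ λ c → Child v c × c ≼ u
  ≼-Child {v} {u} v≼u u≢v with ∈-∃++ v≼u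
  ... | pre , suf , eq with initLast pre
  ... | [] = contradiction (path-injective (trans eq (sym (path-suffix [] eq)))) u≢v
  ... | pre′ ∷ʳ′ c = c , trans (path-suffix pre′ eq′) (cong (c ∷_) (sym (path-suffix (pre′ ∷ʳ c) eq))) ,
                      subst (c ∈ₗ_) (sym eq′) (∈-++⁺ʳ pre′ (here refl))
    where
    eq′ : path u ≡ pre′ ++ c ∷ v ∷ suf
    eq′ = trans eq (++-assoc pre′ (c ∷ []) (v ∷ suf))

  ∈∩subtree⁺ : u ∈ W → w ≼ u → u ∈ W ∩ subtree w
  ∈∩subtree⁺ {w = w} u∈W w≼u = x∈p∩q⁺ (u∈W , ∈⟦⟧⁺ (w ≼?_) w≼u)

  ∈∩subtree⁻ : u ∈ W ∩ subtree w → u ∈ W × w ≼ u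
  ∈∩subtree⁻ {W = W} {w} u∈ with x∈p∩q⁻ W (subtree w) u∈
  ... | u∈W , w≼u = u∈W , ∈⟦⟧⁻ (w ≼?_) w≼u

  ⊆∩subtree-root : W ⊆ W ∩ subtree r
  ⊆∩subtree-root u∈W = ∈∩subtree⁺ u∈W (root-≼ _)

  UpClosed : Subset n → Set
  UpClosed W = ∀ {u v} → u ∈ W → v ≼ u → v ∈ W

  walk-to-ancestor : w ≼ u → ∃ λ xs → Walk u w xs × All (λ x → x ≼ u × w ≼ x) xs
  walk-to-ancestor {w} {u} w≼u with ∈-∃++ w≼u
  ... | pre , suf , eq =
    pre ++ w ∷ [] , walk-prefix pre (subst (Walk u r) eq (path-walk u)) ,
    All.tabulate λ x∈ → subst (_ ∈ₗ_) (sym eq) (prefix x∈) , below (∈-++⁻ pre x∈)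
    where
    prefix : ∀ {x} → x ∈ₗ pre ++ w ∷ [] → x ∈ₗ pre ++ w ∷ suf
    prefix x∈ with ∈-++⁻ pre x∈
    ... | inj₁ x∈pre        = ∈-++⁺ˡ x∈pre
    ... | inj₂ (here refl) = ∈-++⁺ʳ pre (here refl)
    below : ∀ {x} → x ∈ₗ pre ⊎ x ∈ₗ w ∷ [] → w ≼ x
    below (inj₂ (here refl)) = ≼-refl w
    below {x} (inj₁ x∈pre) with ∈-∃++ x∈pre
    ... | p₁ , p₂ , refl = subst (w ∈ₗ_) (sym (path-suffix p₁ (trans eq (++-assoc p₁ (x ∷ p₂) (w ∷ suf)))))
                                 (there (∈-++⁺ʳ p₂ (here refl)))

  ∩subtree-IsRootedSubtree : UpClosed W → w ∈ W → IsRootedSubtree T r (W ∩ subtree w , w)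
  ∩subtree-IsRootedSubtree {W} {w} up w∈W = ∈∩subtree⁺ w∈W (≼-refl w) , connected
    where
    up-to-w : ∀ {u} → u ∈ W ∩ subtree w → ∃ λ xs → Walk u w xs × All (_∈ W ∩ subtree w) xs
    up-to-w u∈ with ∈∩subtree⁻ u∈
    ... | u∈W , w≼u with walk-to-ancestor w≼u
    ... | xs , walk , between = xs , walk , All.map (λ (x≼u , w≼x) → ∈∩subtree⁺ (up u∈W x≼u) w≼x) between
    connected : InducedConnected T (W ∩ subtree w)
    connected u₁ u₂ u₁∈ u₂∈ with up-to-w u₁∈ | up-to-w u₂∈
    ... | _ , walk₁ , all₁ | _ , walk₂ , all₂ with connect walk₁ walk₂
    ... | zs , p , zs⊆ = zs , Path⇒IsPath p , anti-mono zs⊆ (++⁺ all₁ all₂)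

  ∩subtree-BelowRoot : BelowRoot T r (W ∩ subtree w , w)
  ∩subtree-BelowRoot {W} {w} u u∈ xs p =
    subst (w ∈ₗ_) (sym (IsPath⇒≡path p)) (proj₂ (∈∩subtree⁻ {W = W} u∈))

  ∩subtree⊆∪children : W ∩ subtree w ⊆ ⁅ w ⁆ ∪ ⋃[ children w ] (λ c → W ∩ subtree c)
  ∩subtree⊆∪children {W} {w} {u} u∈ with ∈∩subtree⁻ u∈ | u ≟ w
  ... | _ , _ | yes refl = x∈p∪q⁺ (inj₁ (x∈⁅x⁆ u))
  ... | u∈W , w≼u | no u≢w with ≼-Child w≼u u≢w
  ... | c , ch , c≼u = x∈p∪q⁺ (inj₂ (∈⋃⁺ (children w) _ (∈⟦⟧⁺ (Child? w) ch) (∈∩subtree⁺ u∈W c≼u)))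

  children⊆neighbours : children w ⊆ tabulate (adj T w)
  children⊆neighbours {w} c∈ = ∈-tabulate⁺ (adj T w) (Child⇒Adj (∈⟦⟧⁻ (Child? w) c∈))

  ∩subtree-⊂ : w ∈ W → Child w c → W ∩ subtree c ⊂ W ∩ subtree w
  ∩subtree-⊂ {w} {W} w∈W ch = below , w , ∈∩subtree⁺ w∈W (≼-refl w) ,
    λ w∈ → Child⇒⋠ ch (proj₂ (∈∩subtree⁻ {W = W} w∈))
    where
    below : W ∩ subtree _ ⊆ W ∩ subtree w
    below u∈ with ∈∩subtree⁻ u∈
    ... | u∈W , c≼u = ∈∩subtree⁺ u∈W (≼-trans (Child⇒≼ ch) c≼u)

  ∈W⇐∣∩subtree∣>0 : ∀ W → UpClosed W → 0 < ∣ W ∩ subtree w ∣ → w ∈ W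
  ∈W⇐∣∩subtree∣>0 {w} W up 0<∣X∣ with 0<∣p∣⇒nonempty (W ∩ subtree w) 0<∣X∣
  ... | u , u∈ with ∈∩subtree⁻ u∈
  ... | u∈W , w≼u = up u∈W w≼u

  UpClosed-─∩subtree : ∀ w → UpClosed W → UpClosed (W ─ W ∩ subtree w)
  UpClosed-─∩subtree {W} w up {u} {v} u∈ v≼u =
    x∈p∧x∉q⇒x∈p─q (up u∈W v≼u) λ v∈ → u∉ (∈∩subtree⁺ u∈W (≼-trans (proj₂ (∈∩subtree⁻ {W = W} v∈)) v≼u))
    where
    u∈W : u ∈ W
    u∈W = p─q⊆p W (W ∩ subtree w) u∈
    u∉ : u ∉ W ∩ subtree w
    u∉ = x∈p─q⇒x∉q W (W ∩ subtree w) u∈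

  ∣∩subtree∣≤1+degree*k : ∀ W → (∀ {c} → Child w c → ∣ W ∩ subtree c ∣ ≤ k) →
    ∣ W ∩ subtree w ∣ ≤ 1 + degree T w * k
  ∣∩subtree∣≤1+degree*k {w} {k} W small = begin
    ∣ W ∩ subtree w ∣                      ≤⟨ p⊆q⇒∣p∣≤∣q∣ (∩subtree⊆∪children {W} {w}) ⟩
    ∣ ⁅ w ⁆ ∪ ⋃[ children w ] X ∣           ≤⟨ ∣p∪q∣≤∣p∣+∣q∣ ⁅ w ⁆ _ ⟩
    ∣ ⁅ w ⁆ ∣ + ∣ ⋃[ children w ] X ∣       ≤⟨ +-mono-≤ (≤-reflexive (∣⁅x⁆∣≡1 w))
                                                 (∣⋃∣≤∣N∣*k (children w) X (λ c∈ → small (∈⟦⟧⁻ (Child? w) c∈))) ⟩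
    1 + ∣ children w ∣ * k                 ≤⟨ +-monoʳ-≤ 1 (*-monoˡ-≤ k (p⊆q⇒∣p∣≤∣q∣ children⊆neighbours)) ⟩
    1 + degree T w * k                     ∎
    where
    open ≤-Reasoning
    X : Fin n → Subset n
    X c = W ∩ subtree c

module Covering {n : ℕ} (T : Graph n) (tree : IsTree T) (r : Fin n)
                (Δ k : ℕ) (1≤Δ : 1 ≤ Δ) (Δ-bound : MaxDegree≤ T Δ) where

  open RootedTree T tree r

  private variable
    W : Subset n

  GoodPiece : RootedSubtree n → Set
  GoodPiece S = IsRootedSubtree T r S × BelowRoot T r S
              × suc k ≤ ∣ proj₁ S ∣ × ∣ proj₁ S ∣ ≤ 2 * Δ * suc k

  GoodCover : Subset n → Set
  GoodCover W = ∃ λ (𝒮 : List (RootedSubtree n)) →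
    AllPairs (VertexDisjoint T r) 𝒮 × All GoodPiece 𝒮 × All (λ S → proj₁ S ⊆ W) 𝒮 ×
    (∀ {u} → u ∈ W → Any (λ S → u ∈ proj₁ S) 𝒮)

  ∩subtree-GoodPiece : ∀ w → UpClosed W → suc k ≤ ∣ W ∩ subtree w ∣ → ∣ W ∩ subtree w ∣ ≤ 2 * Δ * suc k →
    GoodPiece (W ∩ subtree w , w)
  ∩subtree-GoodPiece {W} w up large small =
    ∩subtree-IsRootedSubtree up (∈W⇐∣∩subtree∣>0 W up (≤-trans (s≤s z≤n) large)) , ∩subtree-BelowRoot ,
    large , small

  single-GoodCover : UpClosed W → suc k ≤ ∣ W ∣ → ∣ W ∣ ≤ 2 * Δ * suc k → GoodCover W
  single-GoodCover {W} up large small =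
    (W ∩ subtree r , r) ∷ [] , [] ∷ [] ,
    ∩subtree-GoodPiece r up (≤-trans large (p⊆q⇒∣p∣≤∣q∣ (⊆∩subtree-root {W}))) (≤-trans (∣p∩q∣≤∣p∣ W _) small) ∷ [] ,
    (λ u∈ → proj₁ (∈∩subtree⁻ u∈)) ∷ [] , λ u∈ → here (⊆∩subtree-root u∈)

  ∣∩subtree∣≤Δ*[1+k] : ∀ W {w} → (∀ {c} → Child w c → ∣ W ∩ subtree c ∣ ≤ k) → ∣ W ∩ subtree w ∣ ≤ Δ * suc k
  ∣∩subtree∣≤Δ*[1+k] W {w} small = ≤-trans (∣∩subtree∣≤1+degree*k W small)
    (≤-trans (+-monoʳ-≤ 1 (*-monoˡ-≤ k (Δ-bound w))) (1+m*n≤m*[1+n] k 1≤Δ))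

  descend : ∀ W → UpClosed W → ∀ v → Acc _<_ ∣ W ∩ subtree v ∣ → suc k ≤ ∣ W ∩ subtree v ∣ →
    ∃ λ w → suc k ≤ ∣ W ∩ subtree w ∣ × (∀ {c} → Child w c → ∣ W ∩ subtree c ∣ ≤ k)
  descend W up v (acc smaller) large with any? (λ c → Child? v c ×-dec (suc k ≤? ∣ W ∩ subtree c ∣))
  ... | yes (c , ch , large′) =
    descend W up c (smaller (p⊂q⇒∣p∣<∣q∣ (∩subtree-⊂ (∈W⇐∣∩subtree∣>0 W up (≤-trans (s≤s z≤n) large)) ch))) large′
  ... | no ¬large = v , large , λ ch → ≤-pred (≰⇒> (λ large′ → ¬large (_ , ch , large′)))

  extend-GoodCover : ∀ w → GoodPiece (W ∩ subtree w , w) → GoodCover (W ─ W ∩ subtree w) → GoodCover W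
  extend-GoodCover {W} w piece (𝒮 , disjoint , good , within , covers) =
    (X , w) ∷ 𝒮 ,
    All.map (λ S⊆ v v∈X v∈S → x∈p─q⇒x∉q W X (S⊆ v∈S) v∈X) within ∷ disjoint ,
    piece ∷ good ,
    (λ u∈ → proj₁ (∈∩subtree⁻ u∈)) ∷ All.map (λ S⊆ {u} u∈ → p─q⊆p W X (S⊆ u∈)) within ,
    covers′
    where
    X : Subset n
    X = W ∩ subtree w
    covers′ : ∀ {u} → u ∈ W → Any (λ S → u ∈ proj₁ S) ((X , w) ∷ 𝒮)
    covers′ u∈W with _ ∈? X
    ... | yes u∈X = here u∈X
    ... | no  u∉X = there (covers (x∈p∧x∉q⇒x∈p─q u∈W u∉X))

  cover : ∀ W → Acc _<_ ∣ W ∣ → UpClosed W → suc k ≤ ∣ W ∣ → GoodCover W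
  cover W (acc smaller) up large with ∣ W ∣ ≤? 2 * Δ * suc k
  ... | yes small = single-GoodCover up large small
  ... | no ¬small with descend W up r (<-wellFounded _) (≤-trans large (p⊆q⇒∣p∣≤∣q∣ (⊆∩subtree-root {W})))
  ... | w , large-X , small-children =
    extend-GoodCover w (∩subtree-GoodPiece w up large-X (≤-trans small-X Δt≤2Δt))
      (cover (W ─ X) (smaller shrink) (UpClosed-─∩subtree w up) large-rest)
    where
    X : Subset n
    X = W ∩ subtree w
    small-X : ∣ X ∣ ≤ Δ * suc k
    small-X = ∣∩subtree∣≤Δ*[1+k] W small-children
    Δt≤2Δt : Δ * suc k ≤ 2 * Δ * suc k
    Δt≤2Δt = subst (Δ * suc k ≤_) (sym (2*m*n≡m*n+m*n Δ (suc k))) (m≤m+n _ _)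
    w∈W : w ∈ W
    w∈W = ∈W⇐∣∩subtree∣>0 W up (≤-trans (s≤s z≤n) large-X)
    shrink : ∣ W ─ X ∣ < ∣ W ∣
    shrink = p∩q≢∅⇒∣p─q∣<∣p∣ W X (w , x∈p∩q⁺ (w∈W , ∈∩subtree⁺ w∈W (≼-refl w)))
    large-rest : suc k ≤ ∣ W ─ X ∣
    large-rest = ≤-remainder 1≤Δ (≰⇒> ¬small)
      (≤-trans (∣p∣≤∣p─q∣+∣q∣ W X) (+-monoʳ-≤ ∣ W ─ X ∣ small-X))

proposition6p5 : (n Δ t : ℕ) → n ≢ 1 → Δ ≢ 1 → t ≤ n → 1 ≤ t →
    (T : Graph n) → (r : Fin n) → IsTree T → MaxDegree≤ T Δ →
    ∃ λ (𝒮 : List (RootedSubtree n)) →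
      AllPairs (VertexDisjoint T r) 𝒮 ×
      All (λ S → IsRootedSubtree T r S × BelowRoot T r S
                 × t ≤ ∣ proj₁ S ∣ × ∣ proj₁ S ∣ ≤ 2 * Δ * t) 𝒮 ×
      Covers T r 𝒮
proposition6p5 zero             Δ (suc k) _   _ () (s≤s z≤n) T r tree Δ-bound
proposition6p5 (suc zero)       Δ (suc k) n≢1 _ _  (s≤s z≤n) T r tree Δ-bound = contradiction refl n≢1
proposition6p5 n@(suc (suc _)) Δ (suc k) _   _ t≤n (s≤s z≤n) T r tree Δ-bound
  with cover ⊤ (<-wellFounded _) (λ _ _ → ∈⊤) (subst (suc k ≤_) (sym (∣⊤∣≡n n)) t≤n)
  where
  1≤Δ : 1 ≤ Δ
  1≤Δ = ≤-trans (Walks.1≤degree T {zero} {suc zero} (proj₁ tree) λ ()) (Δ-bound zero)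
  open Covering T tree r Δ k 1≤Δ Δ-bound
... | 𝒮 , disjoint , good , _ , covers = 𝒮 , disjoint , good , λ _ → covers ∈⊤
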